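{- Let $G$ be a very well-covered graph and let $M$ be a perfect matching of $G$. Then no edge of $M$ is an edge of a chordless cycle $C_q$ in $G$ (i.e., of an induced subgraph of $G$ isomorphic to $C_q$) with $q=3$ or $q\geq 5$.
   Context: All graphs are finite, simple, undirected, without loops or multiple edges. $C_n$ denotes the chordless cycle on $n\ge 3$ vertices. A stable set is a set of pairwise non-adjacent vertices; $\alpha(G)$ is the maximum size of a stable set. A graph $G$ is well-covered if all its maximal stable sets have the same cardinality, and very well-covered if it is well-covered, has no isolated vertices, and $|V(G)|=2\alpha(G)$. A perfect matching is a set of pairwise disjoint edges covering all vertices. -}

module Defs where

open import Data.Nat using (ℕ; zero; suc; _*_; _≤_)
open import Data.Fin using (Fin; toℕ)
open import Data.Fin.Subset using (Subset; _∈_; _∉_; ∣_∣)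
open import Data.Product using (Σ; ∃; ∃-syntax; _×_; _,_)
open import Data.Sum using (_⊎_)
open import Relation.Nullary using (¬_)
open import Relation.Binary.PropositionalEquality using (_≡_)
open import Function.Definitions using (Injective)
open import Level using (0ℓ)

record Graph (n : ℕ) : Set₁ where
  field
    Adj   : Fin n → Fin n → Set
    sym   : ∀ {x y} → Adj x y → Adj y x
    irrefl : ∀ {x} → ¬ Adj x x

module _ {n : ℕ} (G : Graph n) where
  open Graph G

  IsStable : Subset n → Set
  IsStable S = ∀ x y → x ∈ S → y ∈ S → ¬ Adj x y

  IsMaximalStable : Subset n → Set
  IsMaximalStable S = IsStable S × (∀ v → v ∉ S → ∃[ u ] (u ∈ S × Adj u v))

  IsStabilityNumber : ℕ → Set
  IsStabilityNumber k =
    (∃[ S ] (IsStable S × ∣ S ∣ ≡ k)) × (∀ S → IsStable S → ∣ S ∣ ≤ k)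

  IsWellCovered : Set
  IsWellCovered = ∀ S T → IsMaximalStable S → IsMaximalStable T → ∣ S ∣ ≡ ∣ T ∣

  NoIsolatedVertices : Set
  NoIsolatedVertices = ∀ v → ∃[ u ] Adj v u

  IsVeryWellCovered : Set
  IsVeryWellCovered =
    IsWellCovered × NoIsolatedVertices × (∃[ k ] (IsStabilityNumber k × n ≡ 2 * k))

  record PerfectMatching : Set₁ where
    field
      M        : Fin n → Fin n → Set
      M-sym    : ∀ {x y} → M x y → M y x
      M⊆E      : ∀ {x y} → M x y → Adj x y
      covered  : ∀ x → ∃[ y ] M x y
      disjoint : ∀ {x y z} → M x y → M x z → y ≡ z

CycAdj : (q : ℕ) → Fin q → Fin q → Set
CycAdj q i j =
  (suc (toℕ i) ≡ toℕ j) ⊎ (suc (toℕ j) ≡ toℕ i)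
  ⊎ (toℕ i ≡ 0 × suc (toℕ j) ≡ q) ⊎ (toℕ j ≡ 0 × suc (toℕ i) ≡ q)

IsChordlessCycle : {n : ℕ} → Graph n → (q : ℕ) → (Fin q → Fin n) → Set
IsChordlessCycle G q c =
  3 ≤ q × Injective _≡_ _≡_ c
  × (∀ i j → (Graph.Adj G (c i) (c j) → CycAdj q i j) × (CycAdj q i j → Graph.Adj G (c i) (c j)))

-- Let xy be an edge of M, a a neighbour of x and b a neighbour of y with a, b
-- non-adjacent (a = b allowed).  Extend {a, b} to a maximal stable set T.  As G is
-- well-covered, |T| = α(G) = n/2; but T meets each of the n/2 edges of M at most
-- once and misses xy entirely, so |T| < n/2.  Hence every neighbour of x is
-- adjacent to every neighbour of y.  On an induced C_q with q = 3 or q ≥ 5 the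
-- cycle vertices before x and after y are non-adjacent (equal if q = 3), so xy ∉ M.
-- Adjacency is not assumed decidable; the argument runs under a double negation,
-- which is harmless since the conclusion is negative.

module Submission where

open import Defs
open import Data.Nat using (ℕ; _≤_)
open import Data.Fin using (Fin)
open import Data.Product using (_×_)
open import Data.Sum using (_⊎_)
open import Relation.Nullary using (¬_)
open import Relation.Binary.PropositionalEquality using (_≡_)

open import Data.Bool using (true; false; if_then_else_)
open import Data.Empty using (⊥; ⊥-elim)
open import Data.Fin using (zero; suc; toℕ; fromℕ; fromℕ<; inject₁)
open import Data.Fin.Permutation using (Permutation; permutation)
open import Data.Fin.Properties using (any?; all?; sequence; toℕ-fromℕ; toℕ-inject₁; toℕ-fromℕ<; toℕ<n)
open import Data.Fin.Subset using (Subset; _∈_; _∉_; ∣_∣; _∪_; ⁅_⁆; _⊆_; _⊂_; _⊃_)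
open import Data.Fin.Subset.Induction using (Acc; acc; ⊃-wellFounded)
open import Data.Fin.Subset.Properties
  using (_∈?_; x∈p∪q⁻; x∈⁅y⁆⇒x≡y; x∈⁅x⁆; p⊆p∪q; q⊆p∪q; p⊆q⇒∣p∣≤∣q∣)
open import Data.Nat using (zero; suc; _+_; _*_; _<_; s≤s; z≤n; _≟_)
open import Data.Nat.Properties
  using (+-0-monoid; +-0-commutativeMonoid; ≤-trans; +-identityʳ; +-mono-≤; +-monoˡ-≤; <-irrefl; ≤-antisym; ≤∧≢⇒<)
open import Algebra.Properties.Monoid.Sum +-0-monoid using (sum)
open import Algebra.Properties.CommutativeMonoid.Sum +-0-commutativeMonoid using (sum-permute; ∑-distrib-+)
open import Data.Product using (∃; ∃-syntax; Σ-syntax; _,_; proj₁; proj₂)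
open import Data.Sum using (inj₁; inj₂; [_,_])
open import Data.Vec using (_∷_; []; lookup)
open import Data.Vec.Properties using (lookup⇒[]=)
open import Effect.Monad using (RawMonad)
open import Relation.Binary using (Decidable)
open import Relation.Nullary using (Dec; yes; no; ¬?)
open import Relation.Nullary.Decidable using (_×-dec_; _→-dec_; ¬¬-excluded-middle)
open import Relation.Nullary.Negation using (¬¬-Monad)
open import Relation.Binary.PropositionalEquality using (refl; sym; trans; cong; cong₂; subst; module ≡-Reasoning)

¬¬-decidable : ∀ {n} (R : Fin n → Fin n → Set) → ¬ ¬ Decidable R
¬¬-decidable R = ¬¬-sequence λ u → ¬¬-sequence λ v → ¬¬-excluded-middle
  where
  ¬¬-sequence : ∀ {m} {P : Fin m → Set} → (∀ i → ¬ ¬ P i) → ¬ ¬ (∀ i → P i)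
  ¬¬-sequence = sequence (RawMonad.rawApplicative ¬¬-Monad)

indicator : ∀ {n} → Subset n → Fin n → ℕ
indicator p i = if lookup p i then 1 else 0

∣p∣≡∑indicator : ∀ {n} (p : Subset n) → ∣ p ∣ ≡ sum (indicator p)
∣p∣≡∑indicator [] = refl
∣p∣≡∑indicator (true ∷ p) = cong suc (∣p∣≡∑indicator p)
∣p∣≡∑indicator (false ∷ p) = ∣p∣≡∑indicator p

indicator-∉ : ∀ {n} {p : Subset n} {x} → x ∉ p → indicator p x ≡ 0
indicator-∉ {p = p} {x} x∉p with lookup p x in e
... | true = ⊥-elim (x∉p (lookup⇒[]= x p e))
... | false = refl

indicator-+≤1 : ∀ {n} {p : Subset n} {x y} → ¬ (x ∈ p × y ∈ p) → indicator p x + indicator p y ≤ 1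
indicator-+≤1 {p = p} {x} {y} ¬both with lookup p x in e | lookup p y in e′
... | true | true = ⊥-elim (¬both (lookup⇒[]= x p e , lookup⇒[]= y p e′))
... | true | false = s≤s z≤n
... | false | true = s≤s z≤n
... | false | false = z≤n

∑≤n : ∀ {n} (g : Fin n → ℕ) → (∀ i → g i ≤ 1) → sum g ≤ n
∑≤n {zero} g g≤1 = z≤n
∑≤n {suc n} g g≤1 = +-mono-≤ (g≤1 zero) (∑≤n (λ i → g (suc i)) (λ i → g≤1 (suc i)))

∑<n : ∀ {n} (g : Fin n → ℕ) → (∀ i → g i ≤ 1) → ∀ x → g x ≡ 0 → sum g < n
∑<n {suc n} g g≤1 zero gx≡0 rewrite gx≡0 = s≤s (∑≤n (λ i → g (suc i)) (λ i → g≤1 (suc i)))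
∑<n {suc n} g g≤1 (suc x) gx≡0 =
  ≤-trans (s≤s (+-monoˡ-≤ _ (g≤1 zero))) (s≤s (∑<n (λ i → g (suc i)) (λ i → g≤1 (suc i)) x gx≡0))

∈-∪⁅⁆ : ∀ {n} (S : Subset n) v {x} → x ∈ S ∪ ⁅ v ⁆ → x ∈ S ⊎ x ≡ v
∈-∪⁅⁆ S v x∈ with x∈p∪q⁻ S ⁅ v ⁆ x∈
... | inj₁ x∈S = inj₁ x∈S
... | inj₂ x∈v = inj₂ (x∈⁅y⁆⇒x≡y v x∈v)

∈-⁅⁆∪⁅⁆ : ∀ {n} (a b : Fin n) {x} → x ∈ ⁅ a ⁆ ∪ ⁅ b ⁆ → x ≡ a ⊎ x ≡ b
∈-⁅⁆∪⁅⁆ a b x∈ with ∈-∪⁅⁆ ⁅ a ⁆ b x∈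
... | inj₁ x∈a = inj₁ (x∈⁅y⁆⇒x≡y a x∈a)
... | inj₂ x≡b = inj₂ x≡b

module _ {n : ℕ} (G : Graph n) where
  open Graph G renaming (sym to Adj-sym)

  Addable : Subset n → Fin n → Set
  Addable S v = v ∉ S × (∀ u → u ∈ S → ¬ Adj u v)

  ∪-addable-stable : ∀ {S v} → IsStable G S → Addable S v → IsStable G (S ∪ ⁅ v ⁆)
  ∪-addable-stable {S} {v} S-st (_ , v-free) x y x∈ y∈ with ∈-∪⁅⁆ S v x∈ | ∈-∪⁅⁆ S v y∈
  ... | inj₁ x∈S | inj₁ y∈S = S-st x y x∈S y∈S
  ... | inj₁ x∈S | inj₂ refl = v-free x x∈S
  ... | inj₂ refl | inj₁ y∈S = λ vy → v-free y y∈S (Adj-sym vy)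
  ... | inj₂ refl | inj₂ refl = irrefl

  pair-stable : ∀ {a b} → ¬ Adj a b → IsStable G (⁅ a ⁆ ∪ ⁅ b ⁆)
  pair-stable {a} {b} a≁b x y x∈ y∈ with ∈-⁅⁆∪⁅⁆ a b x∈ | ∈-⁅⁆∪⁅⁆ a b y∈
  ... | inj₁ refl | inj₁ refl = irrefl
  ... | inj₁ refl | inj₂ refl = a≁b
  ... | inj₂ refl | inj₁ refl = λ ba → a≁b (Adj-sym ba)
  ... | inj₂ refl | inj₂ refl = irrefl

  module _ (adj? : Decidable Adj) where

    addable? : ∀ S → Dec (∃ (Addable S))
    addable? S = any? λ v → ¬? (v ∈? S) ×-dec all? λ u → u ∈? S →-dec ¬? (adj? u v)

    unaddable⇒maximal : ∀ {S} → IsStable G S → ¬ ∃ (Addable S) → IsMaximalStable G S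
    unaddable⇒maximal {S} S-st no-addable = S-st , dominated
      where
      dominated : ∀ v → v ∉ S → ∃[ u ] (u ∈ S × Adj u v)
      dominated v v∉S with any? (λ u → u ∈? S ×-dec adj? u v)
      ... | yes found = found
      ... | no none = ⊥-elim (no-addable (v , v∉S , λ u u∈S uv → none (u , u∈S , uv)))

    extend-to-maximal : ∀ S → IsStable G S → ∃[ T ] (S ⊆ T × IsMaximalStable G T)
    extend-to-maximal S = go S (⊃-wellFounded S)
      where
      go : ∀ S → Acc _⊃_ S → IsStable G S → ∃[ T ] (S ⊆ T × IsMaximalStable G T)
      go S (acc rec) S-st with addable? S
      ... | no no-addable = S , (λ x∈S → x∈S) , unaddable⇒maximal S-st no-addable
      ... | yes (v , v-addable@(v∉S , _)) =
        let S⊂S′ : S ⊂ S ∪ ⁅ v ⁆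
            S⊂S′ = p⊆p∪q ⁅ v ⁆ , v , q⊆p∪q S ⁅ v ⁆ (x∈⁅x⁆ v) , v∉S
            T , S′⊆T , T-max = go (S ∪ ⁅ v ⁆) (rec S⊂S′) (∪-addable-stable S-st v-addable)
        in T , (λ x∈S → S′⊆T (proj₁ S⊂S′ x∈S)) , T-max

    maximal-stable-size : ∀ {k T} → IsWellCovered G → IsStabilityNumber G k
                        → IsMaximalStable G T → ∣ T ∣ ≡ k
    maximal-stable-size {k} {T} well-covered ((S , S-st , ∣S∣≡k) , α-bound) T-max
      with extend-to-maximal S S-st
    ... | T₀ , S⊆T₀ , T₀-max = trans (well-covered T T₀ T-max T₀-max) ∣T₀∣≡k
      where
      ∣T₀∣≡k : ∣ T₀ ∣ ≡ k
      ∣T₀∣≡k = ≤-antisym (α-bound T₀ (proj₁ T₀-max)) (subst (_≤ ∣ T₀ ∣) ∣S∣≡k (p⊆q⇒∣p∣≤∣q∣ S⊆T₀))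

module _ {n : ℕ} {G : Graph n} (PM : PerfectMatching G) where
  open PerfectMatching PM

  partner : Fin n → Fin n
  partner v = proj₁ (covered v)

  M-partner : ∀ v → M v (partner v)
  M-partner v = proj₂ (covered v)

  M⇒≡partner : ∀ {x y} → M x y → y ≡ partner x
  M⇒≡partner mxy = disjoint mxy (M-partner _)

  partner-involutive : ∀ v → partner (partner v) ≡ v
  partner-involutive v = sym (M⇒≡partner (M-sym (M-partner v)))

  stable-missing-matched-edge : ∀ {T x y} → IsStable G T → M x y → x ∉ T → y ∉ T → 2 * ∣ T ∣ < n
  stable-missing-matched-edge {T} {x} {y} T-st mxy x∉T y∉T = subst (_< n) ∑g≡2∣T∣ (∑<n g g≤1 x gx≡0)
    where
    g : Fin n → ℕ
    g i = indicator T i + indicator T (partner i)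

    g≤1 : ∀ i → g i ≤ 1
    g≤1 i = indicator-+≤1 λ (i∈T , pi∈T) → T-st i (partner i) i∈T pi∈T (M⊆E (M-partner i))

    gx≡0 : g x ≡ 0
    gx≡0 = cong₂ _+_ (indicator-∉ x∉T) (indicator-∉ (subst (_∉ T) (M⇒≡partner mxy) y∉T))

    ∑g≡2∣T∣ : sum g ≡ 2 * ∣ T ∣
    ∑g≡2∣T∣ = begin
      sum g
        ≡⟨ ∑-distrib-+ (indicator T) (λ i → indicator T (partner i)) ⟩
      sum (indicator T) + sum (λ i → indicator T (partner i))
        ≡⟨ cong (sum (indicator T) +_) (sym (sum-permute (indicator T) π)) ⟩
      sum (indicator T) + sum (indicator T)
        ≡⟨ cong₂ _+_ (sym (∣p∣≡∑indicator T)) (sym (∣p∣≡∑indicator T)) ⟩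
      ∣ T ∣ + ∣ T ∣
        ≡⟨ cong (∣ T ∣ +_) (sym (+-identityʳ ∣ T ∣)) ⟩
      2 * ∣ T ∣ ∎
      where
      open ≡-Reasoning
      π : Permutation n n
      π = permutation partner partner partner-involutive partner-involutive

matched-neighbours-adjacent : ∀ {n} {G : Graph n} → IsVeryWellCovered G → (PM : PerfectMatching G)
                            → ∀ {x y a b} → PerfectMatching.M PM x y
                            → Graph.Adj G a x → Graph.Adj G y b → ¬ ¬ Graph.Adj G a b
matched-neighbours-adjacent {n} {G} (well-covered , _ , k , α , n≡2k) PM {x} {y} {a} {b} mxy ax yb a≁b =
  ¬¬-decidable Adj absurd-if-decidable
  where
  open Graph G using (Adj)
  absurd-if-decidable : Decidable Adj → ⊥
  absurd-if-decidable adj? with extend-to-maximal G adj? (⁅ a ⁆ ∪ ⁅ b ⁆) (pair-stable G a≁b)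
  ... | T , ab⊆T , T-max@(T-st , _) =
    <-irrefl 2∣T∣≡n (stable-missing-matched-edge PM T-st mxy x∉T y∉T)
    where
    a∈T : a ∈ T
    a∈T = ab⊆T (p⊆p∪q ⁅ b ⁆ (x∈⁅x⁆ a))
    b∈T : b ∈ T
    b∈T = ab⊆T (q⊆p∪q ⁅ a ⁆ ⁅ b ⁆ (x∈⁅x⁆ b))
    x∉T : x ∉ T
    x∉T x∈T = T-st a x a∈T x∈T ax
    y∉T : y ∉ T
    y∉T y∈T = T-st y b y∈T b∈T yb
    2∣T∣≡n : 2 * ∣ T ∣ ≡ n
    2∣T∣≡n = trans (cong (2 *_) (maximal-stable-size G adj? well-covered α T-max)) (sym n≡2k)

CycSucc : ℕ → ℕ → ℕ → Set
CycSucc q x y = suc x ≡ y ⊎ (suc x ≡ q × y ≡ 0)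

CycSucc⇒CycAdj : ∀ {q} {i j : Fin q} → CycSucc q (toℕ i) (toℕ j) → CycAdj q i j
CycSucc⇒CycAdj (inj₁ i+1≡j) = inj₁ i+1≡j
CycSucc⇒CycAdj (inj₂ (i+1≡q , j≡0)) = inj₂ (inj₂ (inj₂ (j≡0 , i+1≡q)))

CycAdj⇒CycSucc : ∀ {q} {i j : Fin q} → CycAdj q i j
               → CycSucc q (toℕ i) (toℕ j) ⊎ CycSucc q (toℕ j) (toℕ i)
CycAdj⇒CycSucc (inj₁ i+1≡j) = inj₁ (inj₁ i+1≡j)
CycAdj⇒CycSucc (inj₂ (inj₁ j+1≡i)) = inj₂ (inj₁ j+1≡i)
CycAdj⇒CycSucc (inj₂ (inj₂ (inj₁ (i≡0 , j+1≡q)))) = inj₂ (inj₂ (j+1≡q , i≡0))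
CycAdj⇒CycSucc (inj₂ (inj₂ (inj₂ (j≡0 , i+1≡q)))) = inj₁ (inj₂ (i+1≡q , j≡0))

cycle-predecessor : ∀ {q} (i : Fin q) → Σ[ a ∈ Fin q ] CycSucc q (toℕ a) (toℕ i)
cycle-predecessor {suc q} zero = fromℕ q , inj₂ (cong suc (toℕ-fromℕ q) , refl)
cycle-predecessor {suc q} (suc i) = inject₁ i , inj₁ (cong suc (toℕ-inject₁ i))

cycle-successor : ∀ {q} (j : Fin q) → Σ[ b ∈ Fin q ] CycSucc q (toℕ j) (toℕ b)
cycle-successor {suc q} j with suc (toℕ j) ≟ suc q
... | yes j+1≡q = zero , inj₂ (j+1≡q , refl)
... | no j+1≢q = fromℕ< j+1<q , inj₁ (sym (toℕ-fromℕ< j+1<q))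
  where
  j+1<q : suc (toℕ j) < suc q
  j+1<q = ≤∧≢⇒< (toℕ<n j) j+1≢q

ChordlessLength : ℕ → Set
ChordlessLength q = q ≡ 3 ⊎ 5 ≤ q

¬ChordlessLength-1 : ¬ ChordlessLength 1
¬ChordlessLength-1 (inj₂ (s≤s ()))

¬ChordlessLength-2 : ¬ ChordlessLength 2
¬ChordlessLength-2 (inj₂ (s≤s (s≤s ())))

¬ChordlessLength-4 : ¬ ChordlessLength 4
¬ChordlessLength-4 (inj₂ (s≤s (s≤s (s≤s (s≤s ())))))

-- b = a + 3 (mod q), so a → b would force q ∣ 2.
walk-of-length-3-no-forward-chord : ∀ {q a i j b} → ChordlessLength q
  → CycSucc q a i → CycSucc q i j → CycSucc q j b → ¬ CycSucc q a b
walk-of-length-3-no-forward-chord _ (inj₁ refl) (inj₁ refl) (inj₁ refl) (inj₁ ())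
walk-of-length-3-no-forward-chord _ (inj₁ refl) (inj₁ refl) (inj₁ refl) (inj₂ (_ , ()))
walk-of-length-3-no-forward-chord _ (inj₁ refl) (inj₁ refl) (inj₂ (refl , refl)) (inj₁ ())
walk-of-length-3-no-forward-chord _ (inj₁ refl) (inj₁ refl) (inj₂ (refl , refl)) (inj₂ (() , _))
walk-of-length-3-no-forward-chord h (inj₁ refl) (inj₂ (refl , refl)) (inj₁ refl) (inj₁ refl) = ¬ChordlessLength-2 h
walk-of-length-3-no-forward-chord _ (inj₁ refl) (inj₂ (refl , refl)) (inj₁ refl) (inj₂ (() , _))
walk-of-length-3-no-forward-chord _ (inj₁ refl) (inj₂ (refl , refl)) (inj₂ (() , _)) _
walk-of-length-3-no-forward-chord h (inj₂ (refl , refl)) (inj₁ refl) (inj₁ refl) (inj₁ refl) = ¬ChordlessLength-2 h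
walk-of-length-3-no-forward-chord _ (inj₂ (refl , refl)) (inj₁ refl) (inj₁ refl) (inj₂ (_ , ()))
walk-of-length-3-no-forward-chord _ (inj₂ (refl , refl)) (inj₁ refl) (inj₂ (refl , refl)) (inj₁ ())
walk-of-length-3-no-forward-chord h (inj₂ (refl , refl)) (inj₁ refl) (inj₂ (refl , refl)) (inj₂ (refl , refl)) = ¬ChordlessLength-2 h
walk-of-length-3-no-forward-chord h (inj₂ (refl , refl)) (inj₂ (refl , refl)) (inj₁ refl) (inj₁ refl) = ¬ChordlessLength-1 h
walk-of-length-3-no-forward-chord _ (inj₂ (refl , refl)) (inj₂ (refl , refl)) (inj₁ refl) (inj₂ (_ , ()))
walk-of-length-3-no-forward-chord _ (inj₂ (refl , refl)) (inj₂ (refl , refl)) (inj₂ (refl , refl)) (inj₁ ())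
walk-of-length-3-no-forward-chord h (inj₂ (refl , refl)) (inj₂ (refl , refl)) (inj₂ (refl , refl)) (inj₂ (refl , refl)) = ¬ChordlessLength-1 h

-- b = a + 3 (mod q), so b → a would force q ∣ 4.
walk-of-length-3-no-backward-chord : ∀ {q a i j b} → ChordlessLength q
  → CycSucc q a i → CycSucc q i j → CycSucc q j b → ¬ CycSucc q b a
walk-of-length-3-no-backward-chord _ (inj₁ refl) (inj₁ refl) (inj₁ refl) (inj₁ ())
walk-of-length-3-no-backward-chord h (inj₁ refl) (inj₁ refl) (inj₁ refl) (inj₂ (refl , refl)) = ¬ChordlessLength-4 h
walk-of-length-3-no-backward-chord h (inj₁ refl) (inj₁ refl) (inj₂ (refl , refl)) (inj₁ refl) = ¬ChordlessLength-4 h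
walk-of-length-3-no-backward-chord _ (inj₁ refl) (inj₁ refl) (inj₂ (refl , refl)) (inj₂ (() , _))
walk-of-length-3-no-backward-chord h (inj₁ refl) (inj₂ (refl , refl)) (inj₁ refl) (inj₁ refl) = ¬ChordlessLength-4 h
walk-of-length-3-no-backward-chord h (inj₁ refl) (inj₂ (refl , refl)) (inj₁ refl) (inj₂ (refl , refl)) = ¬ChordlessLength-2 h
walk-of-length-3-no-backward-chord _ (inj₁ refl) (inj₂ (refl , refl)) (inj₂ (() , _)) _
walk-of-length-3-no-backward-chord h (inj₂ (refl , refl)) (inj₁ refl) (inj₁ refl) (inj₁ refl) = ¬ChordlessLength-4 h
walk-of-length-3-no-backward-chord _ (inj₂ (refl , refl)) (inj₁ refl) (inj₁ refl) (inj₂ (refl , ()))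
walk-of-length-3-no-backward-chord h (inj₂ (refl , refl)) (inj₁ refl) (inj₂ (refl , refl)) (inj₁ refl) = ¬ChordlessLength-2 h
walk-of-length-3-no-backward-chord _ (inj₂ (refl , refl)) (inj₁ refl) (inj₂ (refl , refl)) (inj₂ (() , _))
walk-of-length-3-no-backward-chord _ (inj₂ (refl , refl)) (inj₂ (refl , refl)) (inj₁ refl) (inj₁ ())
walk-of-length-3-no-backward-chord _ (inj₂ (refl , refl)) (inj₂ (refl , refl)) (inj₁ refl) (inj₂ (() , _))
walk-of-length-3-no-backward-chord _ (inj₂ (refl , refl)) (inj₂ (refl , refl)) (inj₂ (refl , refl)) (inj₁ ())
walk-of-length-3-no-backward-chord h (inj₂ (refl , refl)) (inj₂ (refl , refl)) (inj₂ (refl , refl)) (inj₂ (refl , refl)) = ¬ChordlessLength-1 h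

cycle-step-unmatched : ∀ {n} {G : Graph n} → IsVeryWellCovered G → (PM : PerfectMatching G)
                     → ∀ {q} → ChordlessLength q → (c : Fin q → Fin n) → IsChordlessCycle G q c
                     → ∀ {i j} → CycSucc q (toℕ i) (toℕ j) → ¬ PerfectMatching.M PM (c i) (c j)
cycle-step-unmatched {G = G} vwc PM {q} q-ok c (_ , _ , induced) {i} {j} i→j mij
  with cycle-predecessor i | cycle-successor j
... | a , a→i | b , j→b =
  matched-neighbours-adjacent vwc PM mij (edge a→i) (edge j→b) λ cacb →
    [ walk-of-length-3-no-forward-chord q-ok a→i i→j j→b
    , walk-of-length-3-no-backward-chord q-ok a→i i→j j→b
    ] (CycAdj⇒CycSucc (proj₁ (induced a b) cacb))
  where
  edge : ∀ {u v} → CycSucc q (toℕ u) (toℕ v) → Graph.Adj G (c u) (c v)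
  edge {u} {v} u→v = proj₂ (induced u v) (CycSucc⇒CycAdj u→v)

lemma1 : {n : ℕ} (G : Graph n) → IsVeryWellCovered G → (PM : PerfectMatching G)
         → (q : ℕ) → (q ≡ 3 ⊎ 5 ≤ q) → (c : Fin q → Fin n) → IsChordlessCycle G q c
         → (i j : Fin q) → CycAdj q i j
         → ¬ PerfectMatching.M PM (c i) (c j)
lemma1 G vwc PM q q-ok c chordless i j ij mij with CycAdj⇒CycSucc ij
... | inj₁ i→j = cycle-step-unmatched vwc PM q-ok c chordless i→j mij
... | inj₂ j→i = cycle-step-unmatched vwc PM q-ok c chordless j→i (PerfectMatching.M-sym PM mij)
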